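{- For each $n\ge4$, the number of connected spanning subgraphs of the Schreier graph $\mathcal{B}_n$ of the Basilica group is $$2^{2^{n-1}}\left(1+2^{\frac{n-1}{2}}\right)^4\left(1+2^{\frac{n+1}{2}}\right)\prod_{i=1}^{\frac{n-1}{2}-1}\left(1+2^i\right)^{3\cdot 2^{n-2i-1}}$$ for $n$ odd, and $$2^{2^{n-1}}\left(1+2^{\frac{n}{2}}\right)^3\prod_{i=1}^{\frac{n}{2}-1}\left(1+2^i\right)^{3\cdot 2^{n-2i-1}}$$ for $n$ even. Moreover, these numbers equal $2^2\cdot 3$, $2^2\cdot 3^3$ and $2^4\cdot3^4\cdot5$ for $n=1,2,3$ respectively.
   Context: The Basilica group is generated by the automorphisms $a,b$ of the rooted binary tree defined recursively on finite binary words $w$ by $a(0w)=0\,b(w)$, $a(1w)=1w$, $b(0w)=1\,a(w)$, $b(1w)=0w$. For $n\ge1$, the Schreier graph $\mathcal{B}_n$ is the finite multigraph with vertex set $\{0,1\}^n$ having, for each vertex $u$ and each $s\in\{a,b\}$, one edge joining $u$ and $s(u)$ (a loop if $s(u)=u$). A spanning subgraph is given by a subset of the edge set (loops included, parallel edges distinct) together with all vertices. -}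

module Defs where

open import Data.Bool using (Bool; true; false; T)
open import Data.Nat using (ℕ; zero; suc; _+_; _*_; _∸_; _^_)
open import Data.Vec using (Vec; []; _∷_)
open import Data.Product using (Σ; _×_; _,_; ∃)
open import Data.Sum using (_⊎_)
open import Data.Irrelevant using (Irrelevant)
open import Relation.Binary.PropositionalEquality using (_≡_)
open import Relation.Binary.Construct.Closure.ReflexiveTransitive using (Star)

-- Vertices of B_n: binary words of length n (false = 0, true = 1).
Word : ℕ → Set
Word n = Vec Bool n

mutual
  actA : ∀ {n} → Word n → Word n
  actA []          = []
  actA (false ∷ w) = false ∷ actB w
  actA (true  ∷ w) = true ∷ w

  actB : ∀ {n} → Word n → Word n
  actB []          = []
  actB (false ∷ w) = true ∷ actA w
  actB (true  ∷ w) = false ∷ w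

data Gen : Set where
  a b : Gen

act : Gen → ∀ {n} → Word n → Word n
act a = actA
act b = actB

-- A Bool-valued table indexed by the words of length n (a finite map Word n → Bool
-- with structural equality).
BTable : ℕ → Set
BTable zero    = Bool
BTable (suc n) = BTable n × BTable n   -- (entries for words 0w , entries for words 1w)

lookupT : ∀ {n} → BTable n → Word n → Bool
lookupT {zero}  t       []          = t
lookupT {suc n} (t , _) (false ∷ w) = lookupT t w
lookupT {suc n} (_ , t) (true  ∷ w) = lookupT t w

-- Edges of B_n are indexed by pairs (u , s) with u a vertex and s ∈ {a , b};
-- edge (u , s) joins u and s(u) (a loop if s(u) = u).
-- A spanning subgraph = a subset of the edge set: for each generator s, a table
-- telling which of the edges (u , s) are selected.
SpanningSubgraph : ℕ → Set
SpanningSubgraph n = BTable n × BTable n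

selected : ∀ {n} → SpanningSubgraph n → Gen → Word n → Bool
selected (ta , _ ) a u = lookupT ta u
selected (_  , tb) b u = lookupT tb u

Adjacent : ∀ {n} → SpanningSubgraph n → Word n → Word n → Set
Adjacent H x y = ∃ λ s → (T (selected H s x) × act s x ≡ y) ⊎ (T (selected H s y) × act s y ≡ x)

Connected : ∀ {n} → SpanningSubgraph n → Set
Connected {n} H = (x y : Word n) → Star (Adjacent H) x y

-- The set of connected spanning subgraphs (the connectivity proof is irrelevant,
-- so two elements are equal iff the underlying edge subsets are equal).
ConnectedSpanningSubgraph : ℕ → Set
ConnectedSpanningSubgraph n = Σ (SpanningSubgraph n) λ H → Irrelevant (Connected H)

prodFrom1 : ℕ → (ℕ → ℕ) → ℕ
prodFrom1 zero    f = 1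
prodFrom1 (suc m) f = prodFrom1 m f * f (suc m)

commonProd : ℕ → ℕ → ℕ
commonProd n m = prodFrom1 m (λ i → (1 + 2 ^ i) ^ (3 * 2 ^ (n ∸ 2 * i ∸ 1)))

countEven : ℕ → ℕ
countEven k = 2 ^ (2 ^ (2 * k ∸ 1)) * (1 + 2 ^ k) ^ 3 * commonProd (2 * k) (k ∸ 1)

countOdd : ℕ → ℕ
countOdd k = 2 ^ (2 ^ (2 * k)) * (1 + 2 ^ k) ^ 4 * (1 + 2 ^ (k + 1)) * commonProd (1 + 2 * k) (k ∸ 1)

-- The vertex 1v of B(n+1) carries an a-loop and exactly two b-edges, 0a⁻¹(v) — 1v and 1v — 0v,
-- while the a-edge at 0w joins 0w and 0b(w).  Suppressing the vertices 1v therefore turns B(n+1)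
-- into B(n): the path 0w — 1a(w) — 0a(w) becomes the a-edge at w, the a-edge at 0w becomes the
-- b-edge at w.  A spanning subgraph of B(n+1) is connected iff no 1v loses both of its b-edges and
-- the reduced subgraph of B(n) is connected, a reduced a-edge being present iff both edges of its
-- series pair are.  Weighting every missing a-edge by x and missing b-edge by y, the weighted
-- number C n x y of connected spanning subgraphs thus satisfies C 0 x y = (1+x)(1+y) and
-- C (n+1) x y = (1+x)^(2^n) · C n (2y) x: the a-loops at the 1w are free, and a series pair with
-- exactly one missing edge becomes a missing edge of weight 2y.  Unrolling the recursion two
-- levels at a time from C n 1 1 gives the closed forms.
module Submission where

open import Defs
open import Data.Bool using (Bool; true; false; T; _∧_; _∨_; if_then_else_; T?)
open import Data.Bool.Properties using (T-∧; T-∨)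
open import Data.Empty using (⊥-elim)
open import Data.Fin using (Fin; zero; suc; _↑ˡ_; _↑ʳ_; splitAt)
open import Data.Fin.Properties using (splitAt-↑ˡ; splitAt-↑ʳ; splitAt⁻¹-↑ˡ; splitAt⁻¹-↑ʳ; *↔×)
open import Data.Irrelevant using (Irrelevant; [_])
open import Data.Nat using (ℕ; zero; suc; _≤_; _+_; _*_; _^_; _∸_)
open import Data.Nat.Properties
  using (+-identityʳ; *-identityʳ; +-comm; +-suc; *-comm; *-assoc; *-suc; ^-distribˡ-+-*)
open import Data.Nat.Solver using (module +-*-Solver)
open import Data.Product using (Σ; _×_; _,_; proj₁; proj₂; uncurry)
open import Data.Product.Function.NonDependent.Propositional using (_×-↔_)
open import Data.Sum using (inj₁; inj₂; [_,_]′)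
open import Data.Unit using (tt)
open import Data.Vec using ([]; _∷_; replicate)
open import Data.Vec.Properties using (∷-injectiveʳ)
open import Function using (_∘_)
open import Function.Bundles using (_↔_; mk↔ₛ′; Equivalence)
open import Function.Properties.Inverse using (↔-trans; ↔-sym)
open import Relation.Binary.Core using (_=[_]⇒_)
open import Relation.Binary.Definitions using (Symmetric)
open import Relation.Binary.PropositionalEquality
open import Relation.Binary.Construct.Closure.ReflexiveTransitive
  using (Star; ε; _◅_; _◅◅_; reverse; kleisliStar)
open import Relation.Nullary.Decidable using (recompute)

open +-*-Solver

mutual
  actA⁻¹ : ∀ {n} → Word n → Word n
  actA⁻¹ []          = []
  actA⁻¹ (false ∷ w) = false ∷ actB⁻¹ w
  actA⁻¹ (true  ∷ w) = true ∷ w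

  actB⁻¹ : ∀ {n} → Word n → Word n
  actB⁻¹ []          = []
  actB⁻¹ (false ∷ w) = true ∷ w
  actB⁻¹ (true  ∷ w) = false ∷ actA⁻¹ w

mutual
  actA-actA⁻¹ : ∀ {n} (w : Word n) → actA (actA⁻¹ w) ≡ w
  actA-actA⁻¹ []          = refl
  actA-actA⁻¹ (false ∷ w) = cong (false ∷_) (actB-actB⁻¹ w)
  actA-actA⁻¹ (true  ∷ w) = refl

  actB-actB⁻¹ : ∀ {n} (w : Word n) → actB (actB⁻¹ w) ≡ w
  actB-actB⁻¹ []          = refl
  actB-actB⁻¹ (false ∷ w) = refl
  actB-actB⁻¹ (true  ∷ w) = cong (true ∷_) (actA-actA⁻¹ w)

mutual
  actA⁻¹-actA : ∀ {n} (w : Word n) → actA⁻¹ (actA w) ≡ w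
  actA⁻¹-actA []          = refl
  actA⁻¹-actA (false ∷ w) = cong (false ∷_) (actB⁻¹-actB w)
  actA⁻¹-actA (true  ∷ w) = refl

  actB⁻¹-actB : ∀ {n} (w : Word n) → actB⁻¹ (actB w) ≡ w
  actB⁻¹-actB []          = refl
  actB⁻¹-actB (false ∷ w) = cong (false ∷_) (actA⁻¹-actA w)
  actB⁻¹-actB (true  ∷ w) = refl

data Table (A : Set) : ℕ → Set where
  leaf : A → Table A zero
  node : ∀ {n} → Table A n → Table A n → Table A (suc n)

lookup : ∀ {A n} → Table A n → Word n → A
lookup (leaf x)   []          = x
lookup (node t _) (false ∷ w) = lookup t w
lookup (node _ u) (true  ∷ w) = lookup u w

tabulate : ∀ {A n} → (Word n → A) → Table A n
tabulate {n = zero}  f = leaf (f [])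
tabulate {n = suc n} f = node (tabulate (f ∘ (false ∷_))) (tabulate (f ∘ (true ∷_)))

lookup-tabulate : ∀ {A n} (f : Word n → A) w → lookup (tabulate f) w ≡ f w
lookup-tabulate f []          = refl
lookup-tabulate f (false ∷ w) = lookup-tabulate (f ∘ (false ∷_)) w
lookup-tabulate f (true  ∷ w) = lookup-tabulate (f ∘ (true ∷_)) w

Table-ext : ∀ {A n} {t u : Table A n} → (∀ w → lookup t w ≡ lookup u w) → t ≡ u
Table-ext {t = leaf x}   {leaf y}   eq = cong leaf (eq [])
Table-ext {t = node t₀ t₁} {node u₀ u₁} eq =
  cong₂ node (Table-ext (eq ∘ (false ∷_))) (Table-ext (eq ∘ (true ∷_)))

Table-zero-↔ : ∀ {A} → Table A zero ↔ A
Table-zero-↔ = mk↔ₛ′ (λ { (leaf x) → x }) leaf (λ _ → refl) (λ { (leaf x) → refl })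

Table-suc-↔ : ∀ {A n} → Table A (suc n) ↔ (Table A n × Table A n)
Table-suc-↔ = mk↔ₛ′ (λ { (node t u) → t , u }) (uncurry node) (λ _ → refl) (λ { (node t u) → refl })

^-2^-suc : ∀ m n → m ^ 2 ^ suc n ≡ m ^ 2 ^ n * m ^ 2 ^ n
^-2^-suc m n = begin
  m ^ (2 ^ n + (2 ^ n + 0)) ≡⟨ cong (λ e → m ^ (2 ^ n + e)) (+-identityʳ (2 ^ n)) ⟩
  m ^ (2 ^ n + 2 ^ n)       ≡⟨ ^-distribˡ-+-* m (2 ^ n) (2 ^ n) ⟩
  m ^ 2 ^ n * m ^ 2 ^ n     ∎
  where open ≡-Reasoning

Table-↔ : ∀ m n → Table (Fin m) n ↔ Fin (m ^ 2 ^ n)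
Table-↔ m zero    = subst (λ k → Table (Fin m) zero ↔ Fin k) (sym (*-identityʳ m)) Table-zero-↔
Table-↔ m (suc n) = subst (λ k → Table (Fin m) (suc n) ↔ Fin k) (sym (^-2^-suc m n))
  (↔-trans Table-suc-↔ (↔-trans (Table-↔ m n ×-↔ Table-↔ m n) (↔-sym *↔×)))

isZero : ∀ {m} → Fin (suc m) → Bool
isZero zero    = true
isZero (suc _) = false

select : ∀ {m n} → Table (Fin (suc m)) n → BTable n
select (leaf l)   = isZero l
select (node t u) = select t , select u

lookupT-select : ∀ {m n} (t : Table (Fin (suc m)) n) w → lookupT (select t) w ≡ isZero (lookup t w)
lookupT-select (leaf l)   []          = refl
lookupT-select (node t _) (false ∷ w) = lookupT-select t w
lookupT-select (node _ u) (true  ∷ w) = lookupT-select u w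

lookupT-select-tabulate : ∀ {m n} (f : Word n → Fin (suc m)) w →
                          lookupT (select (tabulate f)) w ≡ isZero (f w)
lookupT-select-tabulate f w = trans (lookupT-select (tabulate f) w) (cong isZero (lookup-tabulate f w))

-- Label zero marks a selected edge; the other x labels of Fin (suc x) give an unselected edge weight x.
Labelling : ℕ → ℕ → ℕ → Set
Labelling n x y = Table (Fin (suc x)) n × Table (Fin (suc y)) n

underlying : ∀ {n x y} → Labelling n x y → SpanningSubgraph n
underlying (ta , tb) = select ta , select tb

ConnectedLabelling : ℕ → ℕ → ℕ → Set
ConnectedLabelling n x y = Σ (Labelling n x y) λ L → Irrelevant (Connected (underlying L))

Σ-irrelevant-≡ : ∀ {A : Set} {P : A → Set} {a a′ : A} {p : Irrelevant (P a)} {p′ : Irrelevant (P a′)} →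
                 a ≡ a′ → (a , p) ≡ (a′ , p′)
Σ-irrelevant-≡ refl = refl

-- The labels of two edges in series, not both unselected, as one label (series (suc i) (suc j) is junk).
series : ∀ {y} → Fin (suc y) → Fin (suc y) → Fin (suc (y + y))
series         zero    zero    = zero
series {y}     zero    (suc j) = suc (y ↑ʳ j)
series {y}     (suc i) _       = suc (i ↑ˡ y)

unseries : ∀ y → Fin (suc (y + y)) → Fin (suc y) × Fin (suc y)
unseries y zero    = zero , zero
unseries y (suc k) = [ (λ i → suc i , zero) , (λ j → zero , suc j) ]′ (splitAt y k)

isZero-series : ∀ {y} (p q : Fin (suc y)) → isZero (series p q) ≡ isZero p ∧ isZero q
isZero-series zero    zero    = refl
isZero-series zero    (suc j) = refl
isZero-series (suc i) q       = refl

unseries-series : ∀ {y} (p q : Fin (suc y)) → T (isZero q ∨ isZero p) → unseries y (series p q) ≡ (p , q)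
unseries-series         zero    zero    _ = refl
unseries-series {y}     zero    (suc j) _ = cong [ _ , _ ]′ (splitAt-↑ʳ y y j)
unseries-series {y}     (suc i) zero    _ = cong [ _ , _ ]′ (splitAt-↑ˡ y i y)

series-unseries : ∀ y (k : Fin (suc (y + y))) → uncurry series (unseries y k) ≡ k
series-unseries y zero    = refl
series-unseries y (suc k) with splitAt y k in eq
... | inj₁ i = cong suc (splitAt⁻¹-↑ˡ eq)
... | inj₂ j = cong suc (splitAt⁻¹-↑ʳ eq)

isZero-unseries : ∀ y (k : Fin (suc (y + y))) →
                  isZero k ≡ isZero (proj₁ (unseries y k)) ∧ isZero (proj₂ (unseries y k))
isZero-unseries y k = trans (cong isZero (sym (series-unseries y k))) (uncurry isZero-series (unseries y k))

unseries-oneSelected : ∀ y (k : Fin (suc (y + y))) →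
                       T (isZero (proj₂ (unseries y k)) ∨ isZero (proj₁ (unseries y k)))
unseries-oneSelected y zero    = tt
unseries-oneSelected y (suc k) with splitAt y k
... | inj₁ _ = tt
... | inj₂ _ = tt

-- Reducing B(n+1) to B(n)

Path : ∀ {n} → SpanningSubgraph n → Word n → Word n → Set
Path H = Star (Adjacent H)

Adjacent-sym : ∀ {n} {H : SpanningSubgraph n} → Symmetric (Adjacent H)
Adjacent-sym (s , inj₁ e) = s , inj₂ e
Adjacent-sym (s , inj₂ e) = s , inj₁ e

-- B₁ v and B₀ (a⁻¹ v) select the two b-edges 1v — 0v and 0a⁻¹(v) — 1v at the vertex 1v.
OnesAttached : ∀ {n} → BTable n → BTable n → Set
OnesAttached B₀ B₁ = ∀ v → T (lookupT B₁ v ∨ lookupT B₀ (actA⁻¹ v))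

module Reduction {n} (A₀ A₁ B₀ B₁ S : BTable n)
                 (S-series : ∀ w → lookupT S w ≡ lookupT B₀ w ∧ lookupT B₁ (actA w)) where

  H : SpanningSubgraph (suc n)
  H = (A₀ , A₁) , (B₀ , B₁)

  Hᵣ : SpanningSubgraph n
  Hᵣ = S , A₀

  -- 1v is merged with a 0-neighbour through a selected b-edge, if it has one.
  contract : Word (suc n) → Word n
  contract (false ∷ w) = w
  contract (true  ∷ v) = if lookupT B₁ v then v else actA⁻¹ v

  contract-edge : ∀ s x → T (selected H s x) → Path Hᵣ (contract x) (contract (act s x))
  contract-edge a (false ∷ w) p = (b , inj₁ (p , refl)) ◅ ε
  contract-edge a (true  ∷ v) p = ε
  contract-edge b (false ∷ w) p with lookupT B₁ (actA w) in e
  ... | true  = (a , inj₁ (S-selected , refl)) ◅ ε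
    where
    S-selected : T (lookupT S w)
    S-selected = subst T (sym (S-series w)) (Equivalence.from T-∧ (p , subst T (sym e) tt))
  ... | false = subst (Path Hᵣ w) (sym (actA⁻¹-actA w)) ε
  contract-edge b (true  ∷ v) p with lookupT B₁ v
  ... | true  = ε
  ... | false = ⊥-elim p

  contract-adjacent : Adjacent H =[ contract ]⇒ Path Hᵣ
  contract-adjacent (s , inj₁ (p , refl)) = contract-edge s _ p
  contract-adjacent (s , inj₂ (p , refl)) = reverse Adjacent-sym (contract-edge s _ p)

  connected⇒reduced : Connected H → Connected Hᵣ
  connected⇒reduced c x y = kleisliStar contract contract-adjacent (c (false ∷ x) (false ∷ y))

  module _ (v : Word n) (B₁v : lookupT B₁ v ≡ false) (B₀a⁻¹v : lookupT B₀ (actA⁻¹ v) ≡ false) where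

    isolated-adjacent : ∀ {z} → Adjacent H (true ∷ v) z → z ≡ true ∷ v
    isolated-adjacent (a , inj₁ (_ , refl)) = refl
    isolated-adjacent (b , inj₁ (p , refl)) = ⊥-elim (subst T B₁v p)
    isolated-adjacent {true ∷ _} (a , inj₂ (_ , eq)) = eq
    isolated-adjacent {false ∷ w} (b , inj₂ (p , eq)) =
      ⊥-elim (subst T B₀a⁻¹v (subst (T ∘ lookupT B₀) w≡a⁻¹v p))
      where
      w≡a⁻¹v : w ≡ actA⁻¹ v
      w≡a⁻¹v = trans (sym (actA⁻¹-actA w)) (cong actA⁻¹ (∷-injectiveʳ eq))

    isolated : ∀ {z} → Path H (true ∷ v) z → z ≡ true ∷ v
    isolated ε          = refl
    isolated (e ◅ path) with isolated-adjacent e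
    ... | refl = isolated path

  connected⇒attached : Connected H → OnesAttached B₀ B₁
  connected⇒attached c v with lookupT B₁ v in B₁v | lookupT B₀ (actA⁻¹ v) in B₀a⁻¹v
  ... | true  | _    = tt
  ... | false | true = tt
  ... | false | false with isolated v B₁v B₀a⁻¹v (c (true ∷ v) (false ∷ replicate n false))
  ... | ()

  expand-edge : ∀ s w → T (selected Hᵣ s w) → Path H (false ∷ w) (false ∷ act s w)
  expand-edge a w p with Equivalence.to T-∧ (subst T (S-series w) p)
  ... | p₀ , p₁ = (b , inj₁ (p₀ , refl)) ◅ (b , inj₁ (p₁ , refl)) ◅ ε
  expand-edge b w p = (a , inj₁ (p , refl)) ◅ ε

  expand-adjacent : Adjacent Hᵣ =[ false ∷_ ]⇒ Path H
  expand-adjacent (s , inj₁ (p , refl)) = expand-edge s _ p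
  expand-adjacent (s , inj₂ (p , refl)) = reverse Adjacent-sym (expand-edge s _ p)

  to-contract : OnesAttached B₀ B₁ → ∀ x → Path H x (false ∷ contract x)
  to-contract _   (false ∷ w) = ε
  to-contract att (true  ∷ v) with lookupT B₁ v in B₁v
  ... | true  = (b , inj₁ (subst T (sym B₁v) tt , refl)) ◅ ε
  ... | false with Equivalence.to T-∨ (att v)
  ...   | inj₁ p = ⊥-elim (subst T B₁v p)
  ...   | inj₂ p = (b , inj₂ (p , cong (true ∷_) (actA-actA⁻¹ v))) ◅ ε

  attached×reduced⇒connected : OnesAttached B₀ B₁ → Connected Hᵣ → Connected H
  attached×reduced⇒connected att c x y =
    to-contract att x ◅◅ kleisliStar (false ∷_) expand-adjacent (c (contract x) (contract y))
                      ◅◅ reverse Adjacent-sym (to-contract att y)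

module SeriesTables (n y : ℕ) where
  open ≡-Reasoning

  seriesTable : Table (Fin (suc y)) n → Table (Fin (suc y)) n → Table (Fin (suc (y + y))) n
  seriesTable t₀ t₁ = tabulate λ w → series (lookup t₀ w) (lookup t₁ (actA w))

  unseries₀ : Table (Fin (suc (y + y))) n → Table (Fin (suc y)) n
  unseries₀ t = tabulate λ w → proj₁ (unseries y (lookup t w))

  unseries₁ : Table (Fin (suc (y + y))) n → Table (Fin (suc y)) n
  unseries₁ t = tabulate λ v → proj₂ (unseries y (lookup t (actA⁻¹ v)))

  select-seriesTable : (t₀ t₁ : Table (Fin (suc y)) n) →
    ∀ w → lookupT (select (seriesTable t₀ t₁)) w ≡ lookupT (select t₀) w ∧ lookupT (select t₁) (actA w)
  select-seriesTable t₀ t₁ w = begin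
    lookupT (select (seriesTable t₀ t₁)) w               ≡⟨ lookupT-select-tabulate _ w ⟩
    isZero (series (lookup t₀ w) (lookup t₁ (actA w)))   ≡⟨ isZero-series _ _ ⟩
    isZero (lookup t₀ w) ∧ isZero (lookup t₁ (actA w))
      ≡⟨ sym (cong₂ _∧_ (lookupT-select t₀ w) (lookupT-select t₁ (actA w))) ⟩
    lookupT (select t₀) w ∧ lookupT (select t₁) (actA w) ∎

  lookup-unseries : (t : Table (Fin (suc (y + y))) n) →
    ∀ w → (lookup (unseries₀ t) w , lookup (unseries₁ t) (actA w)) ≡ unseries y (lookup t w)
  lookup-unseries t w = cong₂ _,_ (lookup-tabulate _ w) (begin
    lookup (unseries₁ t) (actA w)                   ≡⟨ lookup-tabulate _ (actA w) ⟩
    proj₂ (unseries y (lookup t (actA⁻¹ (actA w)))) ≡⟨ cong (proj₂ ∘ unseries y ∘ lookup t) (actA⁻¹-actA w) ⟩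
    proj₂ (unseries y (lookup t w))                 ∎)

  select-unseries : (t : Table (Fin (suc (y + y))) n) →
    ∀ w → lookupT (select t) w ≡ lookupT (select (unseries₀ t)) w ∧ lookupT (select (unseries₁ t)) (actA w)
  select-unseries t w = begin
    lookupT (select t) w   ≡⟨ lookupT-select t w ⟩
    isZero (lookup t w)    ≡⟨ isZero-unseries y (lookup t w) ⟩
    isZero (proj₁ (unseries y (lookup t w))) ∧ isZero (proj₂ (unseries y (lookup t w)))
      ≡⟨ cong (λ (p , q) → isZero p ∧ isZero q) (sym (lookup-unseries t w)) ⟩
    isZero (lookup (unseries₀ t) w) ∧ isZero (lookup (unseries₁ t) (actA w))
      ≡⟨ sym (cong₂ _∧_ (lookupT-select (unseries₀ t) w) (lookupT-select (unseries₁ t) (actA w))) ⟩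
    lookupT (select (unseries₀ t)) w ∧ lookupT (select (unseries₁ t)) (actA w) ∎

  unseries-attached : (t : Table (Fin (suc (y + y))) n) →
                      OnesAttached (select (unseries₀ t)) (select (unseries₁ t))
  unseries-attached t v =
    subst T (sym (cong₂ _∨_ (lookupT-select-tabulate _ v) (lookupT-select-tabulate _ (actA⁻¹ v))))
      (unseries-oneSelected y (lookup t (actA⁻¹ v)))

  seriesTable-unseries : (t : Table (Fin (suc (y + y))) n) → seriesTable (unseries₀ t) (unseries₁ t) ≡ t
  seriesTable-unseries t = Table-ext λ w → begin
    lookup (seriesTable (unseries₀ t) (unseries₁ t)) w  ≡⟨ lookup-tabulate _ w ⟩
    uncurry series (lookup (unseries₀ t) w , lookup (unseries₁ t) (actA w))
      ≡⟨ cong (uncurry series) (lookup-unseries t w) ⟩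
    uncurry series (unseries y (lookup t w))            ≡⟨ series-unseries y (lookup t w) ⟩
    lookup t w                                          ∎

  module _ (t₀ t₁ : Table (Fin (suc y)) n) (att : OnesAttached (select t₀) (select t₁)) where

    oneSelected : ∀ v → T (isZero (lookup t₁ v) ∨ isZero (lookup t₀ (actA⁻¹ v)))
    oneSelected v = subst T (cong₂ _∨_ (lookupT-select t₁ v) (lookupT-select t₀ (actA⁻¹ v))) (att v)

    unseries-seriesTable : ∀ w →
                           unseries y (lookup (seriesTable t₀ t₁) w) ≡ (lookup t₀ w , lookup t₁ (actA w))
    unseries-seriesTable w = trans (cong (unseries y) (lookup-tabulate _ w)) (unseries-series _ _
      (subst (λ u → T (isZero (lookup t₁ (actA w)) ∨ isZero (lookup t₀ u))) (actA⁻¹-actA w)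
             (oneSelected (actA w))))

    unseries₀-seriesTable : unseries₀ (seriesTable t₀ t₁) ≡ t₀
    unseries₀-seriesTable = Table-ext λ w →
      trans (lookup-tabulate _ w) (cong proj₁ (unseries-seriesTable w))

    unseries₁-seriesTable : unseries₁ (seriesTable t₀ t₁) ≡ t₁
    unseries₁-seriesTable = Table-ext λ v → begin
      lookup (unseries₁ (seriesTable t₀ t₁)) v                   ≡⟨ lookup-tabulate _ v ⟩
      proj₂ (unseries y (lookup (seriesTable t₀ t₁) (actA⁻¹ v))) ≡⟨ cong proj₂ (unseries-seriesTable (actA⁻¹ v)) ⟩
      lookup t₁ (actA (actA⁻¹ v))                                ≡⟨ cong (lookup t₁) (actA-actA⁻¹ v) ⟩
      lookup t₁ v                                                ∎

connectedLabelling-suc-↔ : ∀ {n x y} →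
  ConnectedLabelling (suc n) x y ↔ (Table (Fin (suc x)) n × ConnectedLabelling n (y + y) x)
connectedLabelling-suc-↔ {n} {x} {y} = mk↔ₛ′ to from to-from from-to
  where
  open SeriesTables n y

  to : ConnectedLabelling (suc n) x y → Table (Fin (suc x)) n × ConnectedLabelling n (y + y) x
  to ((node ta₀ ta₁ , node tb₀ tb₁) , [ c ]) = ta₁ , (seriesTable tb₀ tb₁ , ta₀) , [ connected⇒reduced c ]
    where open Reduction (select ta₀) (select ta₁) (select tb₀) (select tb₁) _ (select-seriesTable tb₀ tb₁)

  from : Table (Fin (suc x)) n × ConnectedLabelling n (y + y) x → ConnectedLabelling (suc n) x y
  from (ta₁ , (t , ta₀) , [ c ]) =
    (node ta₀ ta₁ , node (unseries₀ t) (unseries₁ t)) , [ attached×reduced⇒connected (unseries-attached t) c ]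
    where
    open Reduction (select ta₀) (select ta₁) (select (unseries₀ t)) (select (unseries₁ t)) _ (select-unseries t)

  to-from : ∀ z → to (from z) ≡ z
  to-from (ta₁ , (t , ta₀) , _) = cong (ta₁ ,_) (Σ-irrelevant-≡ (cong (_, ta₀) (seriesTable-unseries t)))

  from-to : ∀ z → from (to z) ≡ z
  from-to ((node ta₀ ta₁ , node tb₀ tb₁) , [ c ]) = Σ-irrelevant-≡ (cong (node ta₀ ta₁ ,_)
    (cong₂ node (unseries₀-seriesTable tb₀ tb₁ att) (unseries₁-seriesTable tb₀ tb₁ att)))
    where
    open Reduction (select ta₀) (select ta₁) (select tb₀) (select tb₁) _ (select-seriesTable tb₀ tb₁)

    -- c is irrelevant, but attachment is pointwise decidable and hence recomputable from it.
    att : OnesAttached (select tb₀) (select tb₁)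
    att v = recompute (T? _) (connected⇒attached c v)

connectedLabelling-zero-↔ : ∀ {x y} → ConnectedLabelling zero x y ↔ (Fin (suc x) × Fin (suc y))
connectedLabelling-zero-↔ = mk↔ₛ′
  (λ { ((leaf i , leaf j) , _) → i , j })
  (λ (i , j) → (leaf i , leaf j) , [ (λ { [] [] → ε }) ])
  (λ _ → refl)
  (λ { ((leaf i , leaf j) , _) → refl })

connectedCount : ℕ → ℕ → ℕ → ℕ
connectedCount zero    x y = suc x * suc y
connectedCount (suc n) x y = suc x ^ 2 ^ n * connectedCount n (y + y) x

connectedLabelling-↔ : ∀ n x y → ConnectedLabelling n x y ↔ Fin (connectedCount n x y)
connectedLabelling-↔ zero    x y = ↔-trans connectedLabelling-zero-↔ (↔-sym *↔×)
connectedLabelling-↔ (suc n) x y = ↔-trans connectedLabelling-suc-↔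
  (↔-trans (Table-↔ (suc x) n ×-↔ connectedLabelling-↔ n (y + y) x) (↔-sym *↔×))

fromBool : Bool → Fin 2
fromBool true  = zero
fromBool false = suc zero

fromBTable : ∀ {n} → BTable n → Table (Fin 2) n
fromBTable {zero}  t       = leaf (fromBool t)
fromBTable {suc n} (t , u) = node (fromBTable t) (fromBTable u)

select-fromBTable : ∀ {n} (t : BTable n) → select (fromBTable t) ≡ t
select-fromBTable {zero}  true    = refl
select-fromBTable {zero}  false   = refl
select-fromBTable {suc n} (t , u) = cong₂ _,_ (select-fromBTable t) (select-fromBTable u)

fromBTable-select : ∀ {n} (t : Table (Fin 2) n) → fromBTable (select t) ≡ t
fromBTable-select (leaf zero)       = refl
fromBTable-select (leaf (suc zero)) = refl
fromBTable-select (node t u)        = cong₂ node (fromBTable-select t) (fromBTable-select u)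

connectedSpanningSubgraph-↔ : ∀ n → ConnectedSpanningSubgraph n ↔ ConnectedLabelling n 1 1
connectedSpanningSubgraph-↔ n = mk↔ₛ′ to from
  (λ ((ta , tb) , _) → Σ-irrelevant-≡ (cong₂ _,_ (fromBTable-select ta) (fromBTable-select tb)))
  (λ ((ta , tb) , _) → Σ-irrelevant-≡ (cong₂ _,_ (select-fromBTable ta) (select-fromBTable tb)))
  where
  to : ConnectedSpanningSubgraph n → ConnectedLabelling n 1 1
  to ((ta , tb) , [ c ]) =
    (fromBTable ta , fromBTable tb) ,
    [ subst Connected (sym (cong₂ _,_ (select-fromBTable ta) (select-fromBTable tb))) c ]

  from : ConnectedLabelling n 1 1 → ConnectedSpanningSubgraph n
  from ((ta , tb) , c) = (select ta , select tb) , c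

countConnected-↔ : ∀ n → Fin (connectedCount n 1 1) ↔ ConnectedSpanningSubgraph n
countConnected-↔ n = ↔-sym (↔-trans (connectedSpanningSubgraph-↔ n) (connectedLabelling-↔ n 1 1))

-- Closed forms

2^-double : ∀ j → 2 ^ j + 2 ^ j ≡ 2 ^ suc j
2^-double j = cong (2 ^ j +_) (sym (+-identityʳ (2 ^ j)))

^-3*2^ : ∀ m n → m ^ 2 ^ suc n * m ^ 2 ^ n ≡ m ^ (3 * 2 ^ n)
^-3*2^ m n = trans (sym (^-distribˡ-+-* m (2 ^ suc n) (2 ^ n)))
  (cong (m ^_) (solve 1 (λ e → con 2 :* e :+ e := con 3 :* e) refl (2 ^ n)))

prodFrom1-cong : ∀ m {f g : ℕ → ℕ} → (∀ i → f i ≡ g i) → prodFrom1 m f ≡ prodFrom1 m g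
prodFrom1-cong zero    eq = refl
prodFrom1-cong (suc m) eq = cong₂ _*_ (prodFrom1-cong m eq) (eq (suc m))

prodFrom1-suc : ∀ m (f : ℕ → ℕ) → prodFrom1 (suc m) f ≡ f 1 * prodFrom1 m (f ∘ suc)
prodFrom1-suc zero    f = *-comm 1 (f 1)
prodFrom1-suc (suc m) f = begin
  prodFrom1 (suc m) f * f (2 + m)           ≡⟨ cong (_* f (2 + m)) (prodFrom1-suc m f) ⟩
  f 1 * prodFrom1 m (f ∘ suc) * f (2 + m)   ≡⟨ *-assoc (f 1) (prodFrom1 m (f ∘ suc)) (f (2 + m)) ⟩
  f 1 * (prodFrom1 m (f ∘ suc) * f (2 + m)) ∎
  where open ≡-Reasoning

-- r +2* m is r + 2m, but unfolds two levels at a time.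
infixl 6 _+2*_

_+2*_ : ℕ → ℕ → ℕ
r +2* zero  = r
r +2* suc m = suc (suc (r +2* m))

+2*-≡ : ∀ r m → r +2* m ≡ r + 2 * m
+2*-≡ r zero    = sym (+-identityʳ r)
+2*-≡ r (suc m) = trans (cong (2 +_) (+2*-≡ r m))
  (solve 2 (λ r m → con 2 :+ (r :+ con 2 :* m) := r :+ con 2 :* (con 1 :+ m)) refl r m)

dyadicCount : ℕ → ℕ → ℕ
dyadicCount n j = connectedCount n (2 ^ j) (2 ^ j)

dyadicCount-suc-suc : ∀ n j →
  dyadicCount (suc (suc n)) j ≡ (1 + 2 ^ j) ^ 2 ^ suc n * ((1 + 2 ^ suc j) ^ 2 ^ n * dyadicCount n (suc j))
dyadicCount-suc-suc n j =
  cong (λ d → suc (2 ^ j) ^ 2 ^ suc n * (suc d ^ 2 ^ n * connectedCount n d d)) (2^-double j)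

-- commonProd n m is shiftedProd n 0 m.
shiftedProd : ℕ → ℕ → ℕ → ℕ
shiftedProd n j m = prodFrom1 m λ i → (1 + 2 ^ (j + i)) ^ (3 * 2 ^ (n ∸ 2 * i ∸ 1))

shiftedProd-suc : ∀ n j m →
  shiftedProd (suc (suc n)) j (suc m) ≡ (1 + 2 ^ suc j) ^ (3 * 2 ^ (n ∸ 1)) * shiftedProd n (suc j) m
shiftedProd-suc n j m = trans (prodFrom1-suc m _) (cong₂ _*_
  (cong (λ i → (1 + 2 ^ i) ^ (3 * 2 ^ (n ∸ 1))) (+-comm j 1))
  (prodFrom1-cong m λ i → cong₂ (λ k e → (1 + 2 ^ k) ^ (3 * 2 ^ (e ∸ 1)))
    (+-suc j i) (cong (suc (suc n) ∸_) (*-suc 2 i))))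

-- Two levels of the recursion contribute (1+2^j)^(2^(n-1)) and (1+2^(j+1))^(2^(n-2)); the latter
-- merges with the factor (1+2^(j+1))^(2^(n-3)) of the next two levels into the exponent 3·2^(n-3).
dyadicCount-unfold : ∀ r m j →
  dyadicCount (r +2* suc m) j ≡
    (1 + 2 ^ j) ^ 2 ^ (r +2* suc m ∸ 1) * shiftedProd (r +2* suc m) j m
    * (1 + 2 ^ (j + suc m)) ^ 2 ^ r * dyadicCount r (j + suc m)
dyadicCount-unfold r zero j = begin
  dyadicCount (suc (suc r)) j
    ≡⟨ dyadicCount-suc-suc r j ⟩
  X ^ 2 ^ suc r * (Y ^ 2 ^ r * dyadicCount r (suc j))
    ≡⟨ solve 3 (λ x y d → x :* (y :* d) := x :* con 1 :* y :* d) refl (X ^ 2 ^ suc r) (Y ^ 2 ^ r) _ ⟩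
  X ^ 2 ^ suc r * 1 * Y ^ 2 ^ r * dyadicCount r (suc j)
    ≡⟨ cong (λ i → X ^ 2 ^ suc r * 1 * (1 + 2 ^ i) ^ 2 ^ r * dyadicCount r i) (+-comm 1 j) ⟩
  X ^ 2 ^ suc r * 1 * (1 + 2 ^ (j + 1)) ^ 2 ^ r * dyadicCount r (j + 1) ∎
  where
  open ≡-Reasoning
  X = 1 + 2 ^ j
  Y = 1 + 2 ^ suc j
dyadicCount-unfold r (suc m) j = begin
  dyadicCount (suc (suc n)) j
    ≡⟨ dyadicCount-suc-suc n j ⟩
  X ^ 2 ^ suc n * (Y ^ 2 ^ n * dyadicCount n (suc j))
    ≡⟨ cong (λ d → X ^ 2 ^ suc n * (Y ^ 2 ^ n * d)) (dyadicCount-unfold r m (suc j)) ⟩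
  X ^ 2 ^ suc n * (Y ^ 2 ^ n * (Y ^ 2 ^ (n ∸ 1) * P * Z * D))
    ≡⟨ solve 6 (λ x y y′ p z d → x :* (y :* (y′ :* p :* z :* d)) := x :* (y :* y′ :* p) :* z :* d)
         refl (X ^ 2 ^ suc n) (Y ^ 2 ^ n) (Y ^ 2 ^ (n ∸ 1)) P Z D ⟩
  X ^ 2 ^ suc n * (Y ^ 2 ^ n * Y ^ 2 ^ (n ∸ 1) * P) * Z * D
    ≡⟨ cong (λ y → X ^ 2 ^ suc n * (y * P) * Z * D) (^-3*2^ Y (n ∸ 1)) ⟩
  X ^ 2 ^ suc n * (Y ^ (3 * 2 ^ (n ∸ 1)) * P) * Z * D
    ≡⟨ cong (λ p → X ^ 2 ^ suc n * p * Z * D) (sym (shiftedProd-suc n j m)) ⟩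
  X ^ 2 ^ suc n * P′ * Z * D
    ≡⟨ cong (λ i → X ^ 2 ^ suc n * P′ * (1 + 2 ^ i) ^ 2 ^ r * dyadicCount r i) (sym (+-suc j (suc m))) ⟩
  X ^ 2 ^ suc n * P′ * (1 + 2 ^ (j + suc (suc m))) ^ 2 ^ r * dyadicCount r (j + suc (suc m)) ∎
  where
  open ≡-Reasoning
  n = r +2* suc m
  X = 1 + 2 ^ j
  Y = 1 + 2 ^ suc j
  P = shiftedProd n (suc j) m
  P′ = shiftedProd (suc (suc n)) j (suc m)
  Z = (1 + 2 ^ (suc j + suc m)) ^ 2 ^ r
  D = dyadicCount r (suc j + suc m)

connectedCount-even : ∀ m → connectedCount (2 * suc m) 1 1 ≡ countEven (suc m)
connectedCount-even m = begin
  dyadicCount (2 * suc m) 0    ≡⟨ cong (λ n → dyadicCount n 0) (sym (+2*-≡ 0 (suc m))) ⟩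
  dyadicCount (0 +2* suc m) 0  ≡⟨ dyadicCount-unfold 0 m 0 ⟩
  2 ^ 2 ^ (0 +2* suc m ∸ 1) * commonProd (0 +2* suc m) m * Z ^ 1 * (Z * Z)
    ≡⟨ cong (λ n → 2 ^ 2 ^ (n ∸ 1) * commonProd n m * Z ^ 1 * (Z * Z)) (+2*-≡ 0 (suc m)) ⟩
  2 ^ 2 ^ (2 * suc m ∸ 1) * commonProd (2 * suc m) m * Z ^ 1 * (Z * Z)
    ≡⟨ solve 3 (λ x p z → x :* p :* z :^ 1 :* (z :* z) := x :* z :^ 3 :* p)
         refl (2 ^ 2 ^ (2 * suc m ∸ 1)) (commonProd (2 * suc m) m) Z ⟩
  countEven (suc m) ∎
  where
  open ≡-Reasoning
  Z = 1 + 2 ^ suc m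

connectedCount-odd : ∀ m → connectedCount (1 + 2 * suc m) 1 1 ≡ countOdd (suc m)
connectedCount-odd m = begin
  dyadicCount (1 + 2 * suc m) 0    ≡⟨ cong (λ n → dyadicCount n 0) (sym (+2*-≡ 1 (suc m))) ⟩
  dyadicCount (1 +2* suc m) 0      ≡⟨ dyadicCount-unfold 1 m 0 ⟩
  2 ^ 2 ^ (1 +2* suc m ∸ 1) * commonProd (1 +2* suc m) m * Z ^ 2 * (Z ^ 1 * (suc (2 ^ suc m + 2 ^ suc m) * Z))
    ≡⟨ cong₂ (λ n w → 2 ^ 2 ^ (n ∸ 1) * commonProd n m * Z ^ 2 * (Z ^ 1 * (suc w * Z)))
         (+2*-≡ 1 (suc m)) (trans (2^-double (suc m)) (cong (2 ^_) (+-comm 1 (suc m)))) ⟩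
  2 ^ 2 ^ (2 * suc m) * commonProd (1 + 2 * suc m) m * Z ^ 2 * (Z ^ 1 * (W * Z))
    ≡⟨ solve 4 (λ x p z w → x :* p :* z :^ 2 :* (z :^ 1 :* (w :* z)) := x :* z :^ 4 :* w :* p)
         refl (2 ^ 2 ^ (2 * suc m)) (commonProd (1 + 2 * suc m) m) Z W ⟩
  countOdd (suc m) ∎
  where
  open ≡-Reasoning
  Z = 1 + 2 ^ suc m
  W = 1 + 2 ^ (suc m + 1)

mainTheorem12 : ((k : ℕ) → 2 ≤ k → Fin (countEven k) ↔ ConnectedSpanningSubgraph (2 * k))
    × ((k : ℕ) → 2 ≤ k → Fin (countOdd k) ↔ ConnectedSpanningSubgraph (1 + 2 * k))
    × (Fin (2 ^ 2 * 3) ↔ ConnectedSpanningSubgraph 1)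
    × (Fin (2 ^ 2 * 3 ^ 3) ↔ ConnectedSpanningSubgraph 2)
    × (Fin (2 ^ 4 * 3 ^ 4 * 5) ↔ ConnectedSpanningSubgraph 3)
mainTheorem12 = even , odd , countConnected-↔ 1 , countConnected-↔ 2 , countConnected-↔ 3
  where
  -- The closed forms hold from k = 1 on; the hypothesis 2 ≤ k is only needed to rule out k = 0.
  even : (k : ℕ) → 2 ≤ k → Fin (countEven k) ↔ ConnectedSpanningSubgraph (2 * k)
  even zero    ()
  even (suc m) _ = subst (λ c → Fin c ↔ ConnectedSpanningSubgraph (2 * suc m))
                         (connectedCount-even m) (countConnected-↔ (2 * suc m))

  odd : (k : ℕ) → 2 ≤ k → Fin (countOdd k) ↔ ConnectedSpanningSubgraph (1 + 2 * k)
  odd zero    ()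
  odd (suc m) _ = subst (λ c → Fin c ↔ ConnectedSpanningSubgraph (1 + 2 * suc m))
                        (connectedCount-odd m) (countConnected-↔ (1 + 2 * suc m))
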